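{- Let $\mathcal{G}$ be a finite simple undirected graph and let $H_1$, $H_2$ be F-twins in $\mathcal{G}$ with disjoint vertex sets. Then the connected components of $H_1$ and $H_2$ can be arranged as F-twin pairs $(H_{1,j},H_{2,j})$ (each component of $H_1$ and of $H_2$ occurring in exactly one pair) in such a way that, for every $j$, either $H_{1,j}$ and $H_{2,j}$ are both connected components of $\mathcal{G}$, or $H_{1,j}$ and $H_{2,j}$ lie in the same connected component of $\mathcal{G}$ and $d(H_{1,j},H_{2,j})=2$.
   Context: All graphs are finite, undirected, without loops or parallel edges. For a vertex $u$, $\mathcal{N}(u)$ denotes the set of vertices adjacent to $u$. Two induced subgraphs $H_1,H_2$ of $\mathcal{G}$ with vertex sets $V_1,V_2$ are called F-twins if there is a graph isomorphism $\varphi:V_1\to V_2$ between $H_1$ and $H_2$ such that $\mathcal{N}(u)-V_1=\mathcal{N}(\varphi(u))-V_2$ for all $u\in V_1$. The distance $d(u,v)$ between vertices in the same connected component is the length of a shortest path joining them; for disjoint subgraphs $A,B$ lying in the same connected component, $d(A,B)=\min\{d(u,v): u\in A, v\in B\}$. -}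

module Defs where

open import Data.Nat using (ℕ; zero; suc; _<_; _≤_)
open import Data.Bool using (Bool; true; false)
open import Data.Fin using (Fin)
open import Data.Fin.Subset using (Subset; _∈_; _∉_; _⊆_; Nonempty; ⊤)
open import Data.Product using (Σ; Σ-syntax; ∃; ∃-syntax; _×_; _,_; proj₁)
open import Data.Sum using (_⊎_)
open import Function.Bundles using (_⇔_)
open import Function.Definitions using (Bijective)
open import Relation.Binary.PropositionalEquality using (_≡_)
open import Relation.Nullary using (¬_)

record Graph (n : ℕ) : Set where
  field
    adj    : Fin n → Fin n → Bool
    sym    : ∀ x y → adj x y ≡ adj y x
    irrefl : ∀ x → adj x x ≡ false

module _ {n : ℕ} (G : Graph n) where
  open Graph G

  Edge : Fin n → Fin n → Set
  Edge x y = adj x y ≡ true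

  Elem : Subset n → Set
  Elem V = Σ (Fin n) (λ v → v ∈ V)

  FTwins : Subset n → Subset n → Set
  FTwins V₁ V₂ =
    Σ (Elem V₁ → Elem V₂) λ φ →
      Bijective _≡_ _≡_ φ
      × (∀ u v → Edge (proj₁ u) (proj₁ v) ⇔ Edge (proj₁ (φ u)) (proj₁ (φ v)))
      × (∀ u w → (Edge (proj₁ u) w × w ∉ V₁) ⇔ (Edge (proj₁ (φ u)) w × w ∉ V₂))

  -- Path V x y : y is reachable from x by a path whose vertices after x lie in V
  -- (for x ∈ V this is a path in the induced subgraph G[V]).
  data Path (V : Subset n) : Fin n → Fin n → Set where
    here : ∀ {x} → Path V x x
    step : ∀ {x y z} → Edge x y → y ∈ V → Path V y z → Path V x z

  IsComponentOf : Subset n → Subset n → Set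
  IsComponentOf V C =
    C ⊆ V × Nonempty C
    × (∀ x y → x ∈ C → y ∈ V → (y ∈ C ⇔ Path V x y))

  IsComponent : Subset n → Set
  IsComponent C = IsComponentOf ⊤ C

  SameComponent : Subset n → Subset n → Set
  SameComponent A B = ∃[ u ] ∃[ v ] (u ∈ A × v ∈ B × Path ⊤ u v)

  data Walk : ℕ → Fin n → Fin n → Set where
    nil  : ∀ {x} → Walk zero x x
    cons : ∀ {k x y z} → Edge x y → Walk k y z → Walk (suc k) x z

  Dist : Fin n → Fin n → ℕ → Set
  Dist u v m = Walk m u v × (∀ k → k < m → ¬ Walk k u v)

  SetDist : Subset n → Subset n → ℕ → Set
  SetDist A B m =
    (∃[ u ] ∃[ v ] (u ∈ A × v ∈ B × Dist u v m))
    × (∀ u v k → u ∈ A → v ∈ B → Walk k u v → m ≤ k)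

  Disjoint : Subset n → Subset n → Set
  Disjoint A B = ∀ x → x ∈ A → x ∉ B

-- The F-twin map φ is an isomorphism of G[V₁] onto G[V₂], so it maps the
-- components of G[V₁] bijectively onto those of G[V₂], and its restriction to a
-- component C still makes C and φ(C) F-twins.  If some u ∈ C has a neighbour
-- w ∉ C, then w ∉ V₁ since C is closed in G[V₁], so w is also a neighbour of φ(u)
-- and u – w – φ(u) is a walk of length 2; no shorter walk joins V₁ to V₂, as they
-- are disjoint and, by the twin condition, non-adjacent.  Otherwise C is closed
-- in G, hence so is φ(C), and both are components of G.
module Submission where

open import Defs
open import Data.Bool using (true)
open import Data.Bool.Properties using (T-≡) renaming (_≟_ to _≟ᵇ_)
open import Data.Empty using (⊥-elim)
open import Data.Fin using (Fin; _≟_)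
open import Data.Fin.Properties using (any?)
open import Data.Fin.Subset using (Subset; _∈_; _∉_; _⊆_; ⊤; _-_; ⁅_⁆; ∣_∣)
open import Data.Fin.Subset.Properties
  using (_∈?_; ∈⊤; ⊆-antisym; p─q⊆p; x∈p∧x≢y⇒x∈p-y; x∈p⇒∣p-x∣<∣p∣)
open import Data.List using (List; _∷_; length; lookup; map; filter; deduplicate; allFin)
open import Data.List.Membership.Propositional using () renaming (_∈_ to _∈ˡ_)
open import Data.List.Membership.Propositional.Properties
  using (∈-allFin; ∈-lookup; ∈-map⁺; ∈-map⁻; ∈-filter⁺; ∈-filter⁻; ∈-deduplicate⁺; ∈-deduplicate⁻)
open import Data.List.Relation.Unary.All as All using ()
open import Data.List.Relation.Unary.AllPairs using (_∷_)
open import Data.List.Relation.Unary.Any using (index)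
open import Data.List.Relation.Unary.Any.Properties using (lookup-index)
open import Data.List.Relation.Unary.Unique.Propositional using (Unique)
open import Data.List.Relation.Unary.Unique.DecPropositional.Properties using (deduplicate-!)
open import Data.Nat using (ℕ; zero; suc; _≤_; _<_; s≤s; z≤n)
open import Data.Nat.Properties using (<⇒≱; ≤-pred; <-≤-trans; n<1+n)
open import Data.Product using (Σ-syntax; ∃; ∃-syntax; _×_; _,_; proj₁; proj₂)
open import Data.Sum using (_⊎_; inj₁; inj₂; [_,_])
open import Data.Vec using (tabulate)
open import Data.Vec.Properties using (lookup∘tabulate; []=⇒lookup; lookup⇒[]=; ≡-dec)
open import Data.Vec.Properties.WithK using ([]=-irrelevant)
open import Function using (_∘_; id)
open import Function.Bundles using (_⇔_; mk⇔; Equivalence)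
open import Function.Properties.Equivalence using () renaming (sym to ⇔-sym)
open import Relation.Binary.PropositionalEquality
  using (_≡_; refl; sym; trans; cong; subst; subst₂; module ≡-Reasoning)
open import Relation.Nullary using (Dec; yes; no; ¬?)
open import Relation.Nullary.Decidable using (⌊_⌋; _×-dec_; _⊎-dec_; map′; toWitness; fromWitness)
open import Relation.Unary using (Pred; Decidable)

open Equivalence using (to; from)

∈-irrelevant : ∀ {n} {x : Fin n} {p : Subset n} (a b : x ∈ p) → a ≡ b
∈-irrelevant = []=-irrelevant

subset : ∀ {n ℓ} {P : Pred (Fin n) ℓ} → Decidable P → Subset n
subset P? = tabulate (λ x → ⌊ P? x ⌋)

∈-subset : ∀ {n ℓ} {P : Pred (Fin n) ℓ} (P? : Decidable P) {x} → x ∈ subset P? ⇔ P x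
∈-subset P? {x} = mk⇔
  (λ x∈ → toWitness (from T-≡ (trans (sym (lookup∘tabulate _ x)) ([]=⇒lookup x∈))))
  (λ Px → lookup⇒[]= x _ (trans (lookup∘tabulate _ x) (to T-≡ (fromWitness Px))))

lookup-injective : ∀ {a} {A : Set a} {xs : List A} → Unique xs →
                   ∀ {i j} → lookup xs i ≡ lookup xs j → i ≡ j
lookup-injective {xs = _ ∷ _}  (_ ∷ _)      {Fin.zero}  {Fin.zero}  _  = refl
lookup-injective {xs = _ ∷ xs} (x∉ ∷ _)     {Fin.zero}  {Fin.suc j} eq =
  ⊥-elim (All.lookup x∉ (∈-lookup {xs = xs} j) eq)
lookup-injective {xs = _ ∷ xs} (x∉ ∷ _)     {Fin.suc i} {Fin.zero}  eq =
  ⊥-elim (All.lookup x∉ (∈-lookup {xs = xs} i) (sym eq))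
lookup-injective {xs = _ ∷ _}  (_ ∷ unique) {Fin.suc i} {Fin.suc j} eq =
  cong Fin.suc (lookup-injective unique eq)

lookup-unique-index : ∀ {a b} {A : Set a} {B : Set b} {xs : List A} → Unique xs →
  (f : A → B) → (∀ {x y} → x ∈ˡ xs → y ∈ˡ xs → f x ≡ f y → x ≡ y) →
  ∀ {x y} → x ∈ˡ xs → f x ≡ y →
  Σ[ j ∈ Fin (length xs) ] (f (lookup xs j) ≡ y × (∀ j′ → f (lookup xs j′) ≡ y → j′ ≡ j))
lookup-unique-index {xs = xs} unique f f-injective x∈ refl =
  index x∈ , cong f (sym (lookup-index x∈)) , λ j′ eq →
    lookup-injective unique
      (trans (f-injective (∈-lookup {xs = xs} j′) x∈ eq) (lookup-index x∈))

module _ {n : ℕ} (G : Graph n) where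
  open Graph G using (adj)

  edge? : ∀ x y → Dec (Edge G x y)
  edge? x y = adj x y ≟ᵇ true

  edge-sym : ∀ {x y} → Edge G x y → Edge G y x
  edge-sym {x} {y} e = trans (Graph.sym G y x) e

  _++ᵖ_ : ∀ {V x y z} → Path G V x y → Path G V y z → Path G V x z
  here         ++ᵖ q = q
  step e y∈V p ++ᵖ q = step e y∈V (p ++ᵖ q)

  path-reverse : ∀ {V x y} → x ∈ V → Path G V x y → Path G V y x
  path-reverse x∈V here           = here
  path-reverse x∈V (step e y∈V p) = path-reverse y∈V p ++ᵖ step (edge-sym e) x∈V here

  path-mono : ∀ {V W x y} → V ⊆ W → Path G V x y → Path G W x y
  path-mono V⊆W here           = here
  path-mono V⊆W (step e y∈V p) = step e (V⊆W y∈V) (path-mono V⊆W p)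

  -- A path can be cut at its last visit to z.
  path-avoid : ∀ {V x y} → Path G V x y → ∀ z → Path G (V - z) x y ⊎ Path G (V - z) z y
  path-avoid here z = inj₁ here
  path-avoid (step {y = w} e w∈V p) z with path-avoid p z | w ≟ z
  ... | inj₂ q | _        = inj₂ q
  ... | inj₁ q | yes refl = inj₂ q
  ... | inj₁ q | no w≢z   = inj₁ (step e (x∈p∧x≢y⇒x∈p-y w∈V w≢z) q)

  path⇔ : ∀ {V x y} → Path G V x y ⇔ (x ≡ y ⊎ ∃[ z ] (z ∈ V × Edge G x z × Path G (V - z) z y))
  path⇔ {V} = mk⇔ split join
    where
    split : ∀ {x y} → Path G V x y → x ≡ y ⊎ ∃[ z ] (z ∈ V × Edge G x z × Path G (V - z) z y)
    split here           = inj₁ refl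
    split (step e z∈V p) = inj₂ (_ , z∈V , e , [ id , id ] (path-avoid p _))
    join : ∀ {x y} → x ≡ y ⊎ ∃[ z ] (z ∈ V × Edge G x z × Path G (V - z) z y) → Path G V x y
    join (inj₁ refl)              = here
    join (inj₂ (z , z∈V , e , p)) = step e z∈V (path-mono (p─q⊆p V ⁅ z ⁆) p)

  path? : ∀ V x y → Dec (Path G V x y)
  path? V = bounded (suc ∣ V ∣) V (n<1+n _)
    where
    bounded : ∀ m V → ∣ V ∣ < m → ∀ x y → Dec (Path G V x y)
    bounded zero    _ ()    _ _
    bounded (suc m) V ∣V∣<m x y = map′ (from path⇔) (to path⇔) ((x ≟ y) ⊎-dec any? via)
      where
      via : ∀ z → Dec (z ∈ V × Edge G x z × Path G (V - z) z y)
      via z with z ∈? V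
      ... | no z∉V  = no (z∉V ∘ proj₁)
      ... | yes z∈V = map′ (z∈V ,_) proj₂
        (edge? x z ×-dec bounded m (V - z) (<-≤-trans (x∈p⇒∣p-x∣<∣p∣ z∈V) (≤-pred ∣V∣<m)) z y)

  Closed : Subset n → Set
  Closed C = ∀ {x w} → x ∈ C → Edge G x w → w ∈ C

  closed-or-exit : ∀ C → Closed C ⊎ ∃[ x ] ∃[ w ] (x ∈ C × Edge G x w × w ∉ C)
  closed-or-exit C with any? (λ x → x ∈? C ×-dec any? (λ w → edge? x w ×-dec ¬? (w ∈? C)))
  ... | yes (x , x∈C , w , e , w∉C) = inj₂ (x , w , x∈C , e , w∉C)
  ... | no no-exit = inj₁ closed
    where
    closed : Closed C
    closed {x} {w} x∈C e with w ∈? C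
    ... | yes w∈C = w∈C
    ... | no w∉C  = ⊥-elim (no-exit (x , x∈C , w , e , w∉C))

  component : Subset n → Fin n → Subset n
  component V x = subset (λ y → y ∈? V ×-dec path? V x y)

  ∈-component : ∀ {V x y} → y ∈ component V x ⇔ (y ∈ V × Path G V x y)
  ∈-component {V} {x} = ∈-subset (λ y → y ∈? V ×-dec path? V x y)

  component-isComponentOf : ∀ {V x} → x ∈ V → IsComponentOf G V (component V x)
  component-isComponentOf {V} {x} x∈V =
    proj₁ ∘ to ∈-component , (x , from ∈-component (x∈V , here)) , λ y z y∈ z∈V →
      mk⇔ (λ z∈ → path-reverse x∈V (proj₂ (to ∈-component y∈)) ++ᵖ proj₂ (to ∈-component z∈))
          (λ p → from ∈-component (z∈V , proj₂ (to ∈-component y∈) ++ᵖ p))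

  isComponentOf⇒≡component : ∀ {V C x} → IsComponentOf G V C → x ∈ C → C ≡ component V x
  isComponentOf⇒≡component (C⊆V , _ , reach) x∈C = ⊆-antisym
    (λ y∈C → from ∈-component (C⊆V y∈C , to (reach _ _ x∈C (C⊆V y∈C)) y∈C))
    (λ y∈ → let y∈V , p = to ∈-component y∈ in from (reach _ _ x∈C y∈V) p)

  isComponentOf-closed : ∀ {V C x w} → IsComponentOf G V C → x ∈ C → Edge G x w → w ∈ V → w ∈ C
  isComponentOf-closed (_ , _ , reach) x∈C e w∈V = from (reach _ _ x∈C w∈V) (step e w∈V here)

  closed-isComponentOf⇒isComponent : ∀ {V C} → IsComponentOf G V C → Closed C → IsComponent G C
  closed-isComponentOf⇒isComponent {V} {C} (C⊆V , nonempty , reach) closed =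
    (λ _ → ∈⊤) , nonempty , λ x y x∈C _ →
      mk⇔ (λ y∈C → path-mono (λ _ → ∈⊤) (to (reach x y x∈C (C⊆V y∈C)) y∈C)) (stays x∈C)
    where
    stays : ∀ {x y} → x ∈ C → Path G ⊤ x y → y ∈ C
    stays x∈C here         = x∈C
    stays x∈C (step e _ p) = stays (closed x∈C e) p

  components : Subset n → List (Subset n)
  components V = deduplicate (≡-dec _≟ᵇ_) (map (component V) (filter (_∈? V) (allFin n)))

  components-unique : ∀ V → Unique (components V)
  components-unique V = deduplicate-! (≡-dec _≟ᵇ_) _

  ∈-components⁻ : ∀ {V C} → C ∈ˡ components V → IsComponentOf G V C
  ∈-components⁻ {V} C∈ with ∈-map⁻ (component V) (∈-deduplicate⁻ (≡-dec _≟ᵇ_) _ C∈)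
  ... | x , x∈ , refl = component-isComponentOf (proj₂ (∈-filter⁻ (_∈? V) {xs = allFin n} x∈))

  ∈-components⁺ : ∀ {V C} → IsComponentOf G V C → C ∈ˡ components V
  ∈-components⁺ {V} isC@(C⊆V , (x , x∈C) , _) =
    subst (_∈ˡ components V) (sym (isComponentOf⇒≡component isC x∈C))
      (∈-deduplicate⁺ (≡-dec _≟ᵇ_) (∈-map⁺ (component V) (∈-filter⁺ (_∈? V) (∈-allFin x) (C⊆V x∈C))))

  Disjoint-mono : ∀ {A B A′ B′} → A′ ⊆ A → B′ ⊆ B → Disjoint G A B → Disjoint G A′ B′
  Disjoint-mono A′⊆A B′⊆B disjoint x x∈A′ = disjoint x (A′⊆A x∈A′) ∘ B′⊆B

  Elem-≡ : ∀ {V} {a b : Elem G V} → proj₁ a ≡ proj₁ b → a ≡ b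
  Elem-≡ {a = x , p} {b = .x , q} refl = cong (x ,_) (∈-irrelevant p q)

  -- F-twins with φ and φ⁻¹ extended to all vertices, so that no membership proofs
  -- have to be carried around with the vertices.
  record Twinning (V₁ V₂ : Subset n) : Set where
    field
      φ φ⁻¹ : Fin n → Fin n
      φ-∈   : ∀ {x} → x ∈ V₁ → φ x ∈ V₂
      φ⁻¹-∈ : ∀ {y} → y ∈ V₂ → φ⁻¹ y ∈ V₁
      φ⁻¹-φ : ∀ {x} → x ∈ V₁ → φ⁻¹ (φ x) ≡ x
      φ-φ⁻¹ : ∀ {y} → y ∈ V₂ → φ (φ⁻¹ y) ≡ y
      edge-⇔ : ∀ {x y} → x ∈ V₁ → y ∈ V₁ → Edge G x y ⇔ Edge G (φ x) (φ y)
      exit-⇔ : ∀ {x w} → x ∈ V₁ → (Edge G x w × w ∉ V₁) ⇔ (Edge G (φ x) w × w ∉ V₂)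

  extend : ∀ {V} → (Elem G V → Fin n) → Fin n → Fin n
  extend {V} h x with x ∈? V
  ... | yes x∈V = h (x , x∈V)
  ... | no _    = x

  extend-∈ : ∀ {V} (h : Elem G V → Fin n) (a : Elem G V) → extend h (proj₁ a) ≡ h a
  extend-∈ {V} h (x , x∈V) with x ∈? V
  ... | yes x∈V′ = cong (λ p → h (x , p)) (∈-irrelevant x∈V′ x∈V)
  ... | no x∉V   = ⊥-elim (x∉V x∈V)

  FTwins⇒Twinning : ∀ {V₁ V₂} → FTwins G V₁ V₂ → Twinning V₁ V₂
  FTwins⇒Twinning {V₁} {V₂} (φ , (injective , surjective) , iso , exit) = record
    { φ      = φ̂
    ; φ⁻¹    = ψ̂
    ; φ-∈    = λ x∈ → subst (_∈ V₂) (sym (φ̂-on (_ , x∈))) (proj₂ (φ (_ , x∈)))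
    ; φ⁻¹-∈  = λ y∈ → subst (_∈ V₁) (sym (ψ̂-on (_ , y∈))) (proj₂ (ψ (_ , y∈)))
    ; φ⁻¹-φ  = λ x∈ → ψ̂-φ̂ (_ , x∈)
    ; φ-φ⁻¹  = λ y∈ → φ̂-ψ̂ (_ , y∈)
    ; edge-⇔ = λ x∈ y∈ → subst₂ (λ u v → Edge G _ _ ⇔ Edge G u v)
                 (sym (φ̂-on (_ , x∈))) (sym (φ̂-on (_ , y∈))) (iso (_ , x∈) (_ , y∈))
    ; exit-⇔ = λ {_} {w} x∈ → subst (λ u → _ ⇔ (Edge G u w × w ∉ V₂))
                 (sym (φ̂-on (_ , x∈))) (exit (_ , x∈) w)
    }
    where
    open ≡-Reasoning
    ψ : Elem G V₂ → Elem G V₁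
    ψ y = proj₁ (surjective y)
    φ∘ψ : ∀ b → φ (ψ b) ≡ b
    φ∘ψ b = proj₂ (surjective b) refl
    ψ∘φ : ∀ a → ψ (φ a) ≡ a
    ψ∘φ a = injective (φ∘ψ (φ a))
    φ̂ ψ̂ : Fin n → Fin n
    φ̂ = extend (proj₁ ∘ φ)
    ψ̂ = extend (proj₁ ∘ ψ)
    φ̂-on : ∀ a → φ̂ (proj₁ a) ≡ proj₁ (φ a)
    φ̂-on = extend-∈ (proj₁ ∘ φ)
    ψ̂-on : ∀ b → ψ̂ (proj₁ b) ≡ proj₁ (ψ b)
    ψ̂-on = extend-∈ (proj₁ ∘ ψ)
    ψ̂-φ̂ : ∀ a → ψ̂ (φ̂ (proj₁ a)) ≡ proj₁ a
    ψ̂-φ̂ a = begin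
      ψ̂ (φ̂ (proj₁ a))       ≡⟨ cong ψ̂ (φ̂-on a) ⟩
      ψ̂ (proj₁ (φ a))       ≡⟨ ψ̂-on (φ a) ⟩
      proj₁ (ψ (φ a))       ≡⟨ cong proj₁ (ψ∘φ a) ⟩
      proj₁ a               ∎
    φ̂-ψ̂ : ∀ b → φ̂ (ψ̂ (proj₁ b)) ≡ proj₁ b
    φ̂-ψ̂ b = begin
      φ̂ (ψ̂ (proj₁ b))       ≡⟨ cong φ̂ (ψ̂-on b) ⟩
      φ̂ (proj₁ (ψ b))       ≡⟨ φ̂-on (ψ b) ⟩
      proj₁ (φ (ψ b))       ≡⟨ cong proj₁ (φ∘ψ b) ⟩
      proj₁ b               ∎

  Twinning⇒FTwins : ∀ {V₁ V₂} → Twinning V₁ V₂ → FTwins G V₁ V₂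
  Twinning⇒FTwins {V₁} {V₂} T =
    φ′ , (injective , surjective) , (λ a b → edge-⇔ (proj₂ a) (proj₂ b)) , (λ a _ → exit-⇔ (proj₂ a))
    where
    open Twinning T
    φ′ : Elem G V₁ → Elem G V₂
    φ′ (x , x∈) = φ x , φ-∈ x∈
    injective : ∀ {a b} → φ′ a ≡ φ′ b → a ≡ b
    injective {x , x∈} {y , y∈} eq =
      Elem-≡ (trans (sym (φ⁻¹-φ x∈)) (trans (cong (φ⁻¹ ∘ proj₁) eq) (φ⁻¹-φ y∈)))
    surjective : ∀ b → ∃ λ a → ∀ {a′} → a′ ≡ a → φ′ a′ ≡ b
    surjective (y , y∈) = (φ⁻¹ y , φ⁻¹-∈ y∈) , λ { refl → Elem-≡ (φ-φ⁻¹ y∈) }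

  Twinning-sym : ∀ {V₁ V₂} → Twinning V₁ V₂ → Twinning V₂ V₁
  Twinning-sym {V₁} {V₂} T = record
    { φ      = φ⁻¹
    ; φ⁻¹    = φ
    ; φ-∈    = φ⁻¹-∈
    ; φ⁻¹-∈  = φ-∈
    ; φ⁻¹-φ  = φ-φ⁻¹
    ; φ-φ⁻¹  = φ⁻¹-φ
    ; edge-⇔ = λ x∈ y∈ → ⇔-sym (subst₂ (λ u v → _ ⇔ Edge G u v)
                 (φ-φ⁻¹ x∈) (φ-φ⁻¹ y∈) (edge-⇔ (φ⁻¹-∈ x∈) (φ⁻¹-∈ y∈)))
    ; exit-⇔ = λ {_} {w} x∈ → ⇔-sym (subst (λ u → _ ⇔ (Edge G u w × w ∉ V₂))
                 (φ-φ⁻¹ x∈) (exit-⇔ (φ⁻¹-∈ x∈)))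
    }
    where open Twinning T

  path-map : ∀ {V₁ V₂ x y} (T : Twinning V₁ V₂) → x ∈ V₁ →
             Path G V₁ x y → Path G V₂ (Twinning.φ T x) (Twinning.φ T y)
  path-map T x∈ here          = here
  path-map T x∈ (step e y∈ p) = step (to (edge-⇔ x∈ y∈) e) (φ-∈ y∈) (path-map T y∈ p)
    where open Twinning T

  module _ {V₁ V₂ : Subset n} (T : Twinning V₁ V₂) where
    open Twinning T

    image : Subset n → Subset n
    image C = subset (λ y → y ∈? V₂ ×-dec φ⁻¹ y ∈? C)

    ∈-image : ∀ {C y} → y ∈ image C ⇔ (y ∈ V₂ × φ⁻¹ y ∈ C)
    ∈-image {C} = ∈-subset (λ y → y ∈? V₂ ×-dec φ⁻¹ y ∈? C)

    φ-∈-image : ∀ {C x} → C ⊆ V₁ → x ∈ C → φ x ∈ image C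
    φ-∈-image {C} C⊆V₁ x∈C =
      from ∈-image (φ-∈ (C⊆V₁ x∈C) , subst (_∈ C) (sym (φ⁻¹-φ (C⊆V₁ x∈C))) x∈C)

    image-isComponentOf : ∀ {C} → IsComponentOf G V₁ C → IsComponentOf G V₂ (image C)
    image-isComponentOf (C⊆V₁ , (x , x∈C) , reach) =
      proj₁ ∘ to ∈-image , (φ x , φ-∈-image C⊆V₁ x∈C) , λ y z y∈ z∈V₂ →
        let y∈V₂ , ψy∈C = to ∈-image y∈ in
        mk⇔ (λ z∈ → let _ , ψz∈C = to ∈-image z∈ in
               subst₂ (Path G V₂) (φ-φ⁻¹ y∈V₂) (φ-φ⁻¹ z∈V₂)
                 (path-map T (C⊆V₁ ψy∈C) (to (reach _ _ ψy∈C (C⊆V₁ ψz∈C)) ψz∈C)))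
            (λ p → from ∈-image (z∈V₂ ,
               from (reach _ _ ψy∈C (φ⁻¹-∈ z∈V₂)) (path-map (Twinning-sym T) y∈V₂ p)))

    -- Restricting to a component keeps the twin condition: an edge leaving C
    -- leaves V₁, because C is closed in G[V₁], and likewise for image C.
    restrict : ∀ {C} → IsComponentOf G V₁ C → Twinning C (image C)
    restrict {C} isC@(C⊆V₁ , _) = record
      { φ      = φ
      ; φ⁻¹    = φ⁻¹
      ; φ-∈    = φ-∈-image C⊆V₁
      ; φ⁻¹-∈  = proj₂ ∘ to ∈-image
      ; φ⁻¹-φ  = φ⁻¹-φ ∘ C⊆V₁
      ; φ-φ⁻¹  = φ-φ⁻¹ ∘ proj₁ ∘ to ∈-image
      ; edge-⇔ = λ x∈ y∈ → edge-⇔ (C⊆V₁ x∈) (C⊆V₁ y∈)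
      ; exit-⇔ = exit
      }
      where
      exit : ∀ {x w} → x ∈ C → (Edge G x w × w ∉ C) ⇔ (Edge G (φ x) w × w ∉ image C)
      exit {x} {w} x∈C = mk⇔
        (λ (e , w∉C) →
          let e′ , w∉V₂ = to (exit-⇔ (C⊆V₁ x∈C))
                            (e , w∉C ∘ isComponentOf-closed isC x∈C e)
          in e′ , w∉V₂ ∘ proj₁ ∘ to ∈-image)
        (λ (e′ , w∉D) →
          let e , w∉V₁ = from (exit-⇔ (C⊆V₁ x∈C))
                           (e′ , w∉D ∘ isComponentOf-closed (image-isComponentOf isC)
                                                            (φ-∈-image C⊆V₁ x∈C) e′)
          in e , w∉V₁ ∘ C⊆V₁)

    closed-transfer : Closed V₁ → Closed V₂
    closed-transfer closed {y} {w} y∈V₂ e with w ∈? V₂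
    ... | yes w∈V₂ = w∈V₂
    ... | no w∉V₂  =
      let e′ , w∉V₁ = to (Twinning.exit-⇔ (Twinning-sym T) y∈V₂) (e , w∉V₂)
      in ⊥-elim (w∉V₁ (closed (φ⁻¹-∈ y∈V₂) e′))

    twins-walk-≥2 : ∀ {a b k} → Disjoint G V₁ V₂ → a ∈ V₁ → b ∈ V₂ → Walk G k a b → 2 ≤ k
    twins-walk-≥2 disjoint a∈ b∈ nil                 = ⊥-elim (disjoint _ a∈ b∈)
    twins-walk-≥2 disjoint a∈ b∈ (cons e nil)        =
      ⊥-elim (proj₂ (to (exit-⇔ a∈) (e , λ b∈V₁ → disjoint _ b∈V₁ b∈)) b∈)
    twins-walk-≥2 disjoint a∈ b∈ (cons _ (cons _ _)) = s≤s (s≤s z≤n)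

    twins-dichotomy : ∀ {W₁ W₂} → Disjoint G V₁ V₂ →
      IsComponentOf G W₁ V₁ → IsComponentOf G W₂ V₂ →
      (IsComponent G V₁ × IsComponent G V₂) ⊎ (SameComponent G V₁ V₂ × SetDist G V₁ V₂ 2)
    twins-dichotomy disjoint isV₁ isV₂ with closed-or-exit V₁
    ... | inj₁ closed = inj₁ ( closed-isComponentOf⇒isComponent isV₁ closed
                             , closed-isComponentOf⇒isComponent isV₂ (closed-transfer closed))
    ... | inj₂ (x , w , x∈ , e , w∉) = inj₂
      ( (x , φ x , x∈ , φ-∈ x∈ , step e ∈⊤ (step (edge-sym e′) ∈⊤ here))
      , ( (x , φ x , x∈ , φ-∈ x∈ , cons e (cons (edge-sym e′) nil) ,
            λ k k<2 walk → <⇒≱ k<2 (twins-walk-≥2 disjoint x∈ (φ-∈ x∈) walk))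
        , λ a b k a∈ b∈ → twins-walk-≥2 disjoint a∈ b∈))
      where
      e′ : Edge G (φ x) w
      e′ = proj₁ (to (exit-⇔ x∈) (e , w∉))

  image-sym-image : ∀ {V₁ V₂ C} (T : Twinning V₁ V₂) → C ⊆ V₁ →
                    image (Twinning-sym T) (image T C) ≡ C
  image-sym-image {C = C} T C⊆V₁ = ⊆-antisym
    (λ x∈ → let x∈V₁ , φx∈ = to (∈-image (Twinning-sym T)) x∈ in
            subst (_∈ C) (φ⁻¹-φ x∈V₁) (proj₂ (to (∈-image T) φx∈)))
    (λ x∈C → from (∈-image (Twinning-sym T)) (C⊆V₁ x∈C , φ-∈-image T C⊆V₁ x∈C))
    where open Twinning T

  image-injective : ∀ {V₁ V₂ C C′} (T : Twinning V₁ V₂) → C ⊆ V₁ → C′ ⊆ V₁ →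
                    image T C ≡ image T C′ → C ≡ C′
  image-injective T C⊆V₁ C′⊆V₁ eq = begin
    _                                    ≡⟨ sym (image-sym-image T C⊆V₁) ⟩
    image (Twinning-sym T) (image T _)   ≡⟨ cong (image (Twinning-sym T)) eq ⟩
    image (Twinning-sym T) (image T _)   ≡⟨ image-sym-image T C′⊆V₁ ⟩
    _                                    ∎
    where open ≡-Reasoning

proposition3 : ∀ {n : ℕ} (G : Graph n) (V₁ V₂ : Subset n) →
    FTwins G V₁ V₂ → Disjoint G V₁ V₂ →
    Σ[ k ∈ ℕ ] Σ[ C₁ ∈ (Fin k → Subset n) ] Σ[ C₂ ∈ (Fin k → Subset n) ]
      ((∀ j → IsComponentOf G V₁ (C₁ j) × IsComponentOf G V₂ (C₂ j))
      × (∀ C → IsComponentOf G V₁ C →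
           Σ[ j ∈ Fin k ] (C₁ j ≡ C × (∀ j′ → C₁ j′ ≡ C → j′ ≡ j)))
      × (∀ C → IsComponentOf G V₂ C →
           Σ[ j ∈ Fin k ] (C₂ j ≡ C × (∀ j′ → C₂ j′ ≡ C → j′ ≡ j)))
      × (∀ j → FTwins G (C₁ j) (C₂ j)
           × ((IsComponent G (C₁ j) × IsComponent G (C₂ j))
              ⊎ (SameComponent G (C₁ j) (C₂ j) × SetDist G (C₁ j) (C₂ j) 2))))
proposition3 G V₁ V₂ twins disjoint =
  length Cs , C₁ , C₂ , (λ j → isC₁ j , isC₂ j) , cover₁ , cover₂ , λ j →
    Twinning⇒FTwins G (restrict G T (isC₁ j)) ,
    twins-dichotomy G (restrict G T (isC₁ j))
      (Disjoint-mono G (proj₁ (isC₁ j)) (proj₁ (isC₂ j)) disjoint) (isC₁ j) (isC₂ j)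
  where
  T : Twinning G V₁ V₂
  T = FTwins⇒Twinning G twins
  Cs : List (Subset _)
  Cs = components G V₁
  C₁ C₂ : Fin (length Cs) → Subset _
  C₁ = lookup Cs
  C₂ = image G T ∘ C₁
  isC₁ : ∀ j → IsComponentOf G V₁ (C₁ j)
  isC₁ j = ∈-components⁻ G (∈-lookup {xs = Cs} j)
  isC₂ : ∀ j → IsComponentOf G V₂ (C₂ j)
  isC₂ j = image-isComponentOf G T (isC₁ j)
  cover₁ : ∀ C → IsComponentOf G V₁ C →
           Σ[ j ∈ Fin (length Cs) ] (C₁ j ≡ C × (∀ j′ → C₁ j′ ≡ C → j′ ≡ j))
  cover₁ C isC = lookup-unique-index (components-unique G V₁) id (λ _ _ → id)
    (∈-components⁺ G isC) refl
  cover₂ : ∀ D → IsComponentOf G V₂ D →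
           Σ[ j ∈ Fin (length Cs) ] (C₂ j ≡ D × (∀ j′ → C₂ j′ ≡ D → j′ ≡ j))
  cover₂ D isD = lookup-unique-index (components-unique G V₁) (image G T)
    (λ C∈ C′∈ → image-injective G T (proj₁ (∈-components⁻ G C∈)) (proj₁ (∈-components⁻ G C′∈)))
    (∈-components⁺ G (image-isComponentOf G (Twinning-sym G T) isD))
    (image-sym-image G (Twinning-sym G T) (proj₁ isD))
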